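{- Let $G$ be a finite simple graph which is 5-connected and is a contraction critical quasi 5-connected graph. Let $A$ be a nontrivial fragment of $G$. If there exists a vertex $x\in N_G(A)$ such that $|N_G(x)\cap A|=1$, then $|A|=2$.
   Context: All graphs are finite, simple and undirected. For $S\subseteq V(G)$, $N_G(S)=\bigcup_{v\in S}N_G(v)\setminus S$. For an edge $e=xy$, $G/e$ denotes the graph obtained by deleting $e$, identifying $x$ and $y$, and replacing multiple edges by single edges. A cut of a connected graph $G$ is a set $T\subseteq V(G)$ with $G-T$ disconnected; a $k$-cut has $k$ vertices. A $k$-cut $T$ is nontrivial if the components of $G-T$ can be partitioned into two subgraphs each with at least two vertices. A graph is quasi $k$-connected if it is $(k-1)$-connected and has no nontrivial $(k-1)$-cut. An edge $e$ of a quasi $k$-connected graph $G$ is quasi $k$-contractible if $G/e$ is quasi $k$-connected; $G$ is a contraction critical quasi $k$-connected graph if it has no quasi $k$-contractible edge. Let $\kappa(G)$ be the connectivity of $G$ and $\mathcal{T}(G)$ the set of cuts $T$ with $|T|=\kappa(G)$. For $T\in\mathcal{T}(G)$, a $T$-fragment is the union of the vertex sets of at least one but not all components of $G-T$; a fragment is a $T$-fragment for some $T\in\mathcal{T}(G)$. A fragment $A$ is nontrivial if $|A|\ge 2$ and $|V(G)\setminus(A\cup N_G(A))|\ge 2$. -}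

module Defs where

open import Data.Nat using (ℕ; zero; suc; _≤_; _<_)
open import Data.Bool using (Bool; true; false; not; _∧_; _∨_)
open import Data.Fin using (Fin; zero; suc; punchIn; _≟_)
open import Data.Fin.Subset public using (Subset; _∈_; _∉_; _⊆_; ∁; _∩_; _∪_; ∣_∣)
open import Data.Vec using (tabulate; lookup)
open import Data.Product using (Σ; ∃; ∃-syntax; _×_)
open import Data.Empty using (⊥)
open import Relation.Nullary using (¬_)
open import Relation.Nullary.Decidable using (⌊_⌋)
open import Relation.Binary.PropositionalEquality using (_≡_)

Graph : ℕ → Set
Graph n = Fin n → Fin n → Bool

IsSimple : ∀ {n} → Graph n → Set
IsSimple {n} G = (∀ u v → G u v ≡ G v u) × (∀ u → G u u ≡ false)

anyFin : ∀ {n} → (Fin n → Bool) → Bool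
anyFin {zero}  f = false
anyFin {suc n} f = f zero ∨ anyFin (λ i → f (suc i))

nbhd : ∀ {n} → Graph n → Fin n → Subset n
nbhd G x = tabulate (G x)

N : ∀ {n} → Graph n → Subset n → Subset n
N G S = tabulate (λ v → not (lookup S v) ∧ anyFin (λ u → lookup S u ∧ G u v))

-- walks in G - T (all vertices after the start avoid T)
data Reach {n} (G : Graph n) (T : Subset n) : Fin n → Fin n → Set where
  here : ∀ {u} → Reach G T u u
  step : ∀ {u v w} → G u v ≡ true → v ∉ T → Reach G T v w → Reach G T u w

Disconnected : ∀ {n} → Graph n → Subset n → Set
Disconnected G T = ∃[ u ] ∃[ v ] (u ∉ T × v ∉ T × ¬ Reach G T u v)

KConnected : ℕ → ∀ {n} → Graph n → Set
KConnected k {n} G = k < n × (∀ T → ∣ T ∣ < k → ¬ Disconnected G T)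

-- X is a union of vertex sets of components of G - T
-- (X ⊆ V \ T and no edge of G - T between X and the rest)
UnionOfComponents : ∀ {n} → Graph n → Subset n → Subset n → Set
UnionOfComponents G T X =
  (∀ u → u ∈ X → u ∉ T) ×
  (∀ u v → u ∈ X → v ∉ T → v ∉ X → G u v ≡ false)

-- T is a nontrivial k-cut: components of G - T split into two parts,
-- each with at least two vertices
NontrivialCut : ℕ → ∀ {n} → Graph n → Subset n → Set
NontrivialCut k G T =
  ∣ T ∣ ≡ k × Disconnected G T ×
  ∃[ X ] (UnionOfComponents G T X × 2 ≤ ∣ X ∣ × 2 ≤ ∣ ∁ (T ∪ X) ∣)

-- quasi k-connected: (k-1)-connected with no nontrivial (k-1)-cut (k ≥ 1 in use)
QuasiConnected : ℕ → ∀ {n} → Graph n → Set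
QuasiConnected zero    G = ⊥
QuasiConnected (suc k) G = KConnected k G × (∀ T → ¬ NontrivialCut k G T)

-- G/e for e = xy: delete y, let x represent the identified vertex.
-- Vertices of G/e are Fin m, vertex i standing for punchIn y i.
contract : ∀ {m} → Graph (suc m) → Fin (suc m) → Fin (suc m) → Graph m
contract G x y i j =
  not ⌊ i ≟ j ⌋ ∧
  (G u v ∨ (⌊ u ≟ x ⌋ ∧ G v y) ∨ (⌊ v ≟ x ⌋ ∧ G u y))
  where
  u = punchIn y i
  v = punchIn y j

QuasiContractible : ℕ → ∀ {n} → Graph n → Fin n → Fin n → Set
QuasiContractible k {zero}  G x y = ⊥
QuasiContractible k {suc m} G x y = QuasiConnected k (contract G x y)

ContractionCriticalQuasi : ℕ → ∀ {n} → Graph n → Set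
ContractionCriticalQuasi k G =
  QuasiConnected k G × (∀ x y → G x y ≡ true → ¬ QuasiContractible k G x y)

MinCut : ∀ {n} → Graph n → Subset n → Set
MinCut G T = Disconnected G T × (∀ T' → Disconnected G T' → ∣ T ∣ ≤ ∣ T' ∣)

-- A is a T-fragment: union of at least one but not all components of G - T
FragmentOf : ∀ {n} → Graph n → Subset n → Subset n → Set
FragmentOf G T A =
  UnionOfComponents G T A × (∃[ u ] u ∈ A) × (∃[ v ] (v ∉ T × v ∉ A))

Fragment : ∀ {n} → Graph n → Subset n → Set
Fragment G A = ∃[ T ] (MinCut G T × FragmentOf G T A)

NontrivialFragment : ∀ {n} → Graph n → Subset n → Set
NontrivialFragment G A =
  Fragment G A × 2 ≤ ∣ A ∣ × 2 ≤ ∣ ∁ (A ∪ N G A) ∣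

-- Suppose |A| ≥ 3 and let a be the unique neighbour of x in A.  As G is contraction critical,
-- G/xa is not quasi 5-connected, and since G is 5-connected this forces xa into a nontrivial
-- 5-cut S of G, with sides C and D of size at least 2.  Cross S, C, D with A, N(A) and
-- B = V − (A ∪ N(A)).  If a side Y meets A, then (A ∩ S) ∪ (N(A) ∩ S − x) ∪ (N(A) ∩ Y)
-- separates A ∩ Y from x (the only A-neighbour of x is a ∈ S), so |N(A) ∩ Y| > |B ∩ S|;
-- if Y meets B, then (N(A) ∩ S) ∪ (B ∩ S) ∪ (N(A) ∩ Y) separates B ∩ Y from a, so
-- |N(A) ∩ Y| ≥ |A ∩ S|.  With |N(A)| ≤ |T| ≤ |S| = 5 (T the minimum cut of which A is a
-- fragment) and x ∈ N(A) ∩ S, a case analysis on which of these corners are empty contradicts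
-- |A| ≥ 3, |B| ≥ 2 and |C|, |D| ≥ 2.

module Submission where

open import Defs
open import Data.Nat using (ℕ; zero; suc; _+_; _≤_; _<_; z≤n; s≤s; z<s)
open import Data.Nat.Properties
  using ( ≤-trans; ≤-reflexive; <⇒≤; ≤-<-trans; ≤-pred; n≤1+n; m≤m+n; 1+n≰n; <⇒≱; ≮⇒≥; >⇒≢
        ; m≤n⇒m<n∨m≡n; +-suc; +-comm; +-assoc; +-identityʳ; +-mono-≤; +-monoˡ-≤; +-monoʳ-≤
        ; +-mono-<-≤; +-monoˡ-<; +-monoʳ-<; +-cancelˡ-≤; +-cancelˡ-<; +-commutativeSemigroup
        ; module ≤-Reasoning )
open import Data.Bool using (Bool; true; false; not; _∧_)
open import Data.Bool.Properties using (∧-conicalˡ; ∧-conicalʳ; ¬-not; ∨-zeroʳ)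
open import Data.Fin using (Fin; zero; suc; punchIn; punchOut; _≟_)
open import Data.Fin.Properties using (punchIn-punchOut; punchIn-injective; punchInᵢ≢i)
open import Data.Fin.Subset
  using (Subset; inside; outside; _∈_; _∉_; _⊆_; ∁; _∪_; _∩_; _-_; ∣_∣; Nonempty; Empty)
  renaming (⊥ to ∅)
open import Data.Fin.Subset.Properties
  using ( _∈?_; nonempty?; x∈p∩q⁺; x∈p∩q⁻; x∈p∪q⁺; x∈p∪q⁻; x∈∁p⇒x∉p; x∉p⇒x∈∁p; ∩-comm; ∩-distribˡ-∪
        ; Empty-unique; ∣⊥∣≡0; ∣p∣≤∣x∷p∣; p⊆q⇒∣p∣≤∣q∣; p─q⊆p; x∈p∧x≢y⇒x∈p-y; x∈p⇒∣p-x∣<∣p∣ )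
open import Data.Vec using (_∷_; []; lookup; tabulate; there)
open import Data.Vec.Properties
  using (lookup∘tabulate; []=⇒lookup; lookup⇒[]=; tabulate-cong; tabulate∘lookup)
open import Data.Product using (_,_; _×_; ∃-syntax; proj₁; proj₂)
open import Data.Sum using (_⊎_; inj₁; inj₂; [_,_])
open import Data.Empty using (⊥; ⊥-elim)
open import Function using (_∘_; id; case_of_)
open import Relation.Nullary using (¬_; Dec; yes; no; contradiction)
open import Relation.Nullary.Decidable using (⌊_⌋; isYes≗does; dec-true; dec-false)
open import Relation.Binary.PropositionalEquality hiding ([_])
open import Algebra.Properties.CommutativeSemigroup +-commutativeSemigroup
  using (xy∙z≈xz∙y; xy∙z≈y∙xz; xy∙z≈yz∙x)

private variable
  n k : ℕ
  i j u v w : Fin n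
  G : Graph n
  p q A S T X : Subset n

∣p∪q∣+∣p∩q∣≡∣p∣+∣q∣ : ∀ (p q : Subset n) → ∣ p ∪ q ∣ + ∣ p ∩ q ∣ ≡ ∣ p ∣ + ∣ q ∣
∣p∪q∣+∣p∩q∣≡∣p∣+∣q∣ []            []            = refl
∣p∪q∣+∣p∩q∣≡∣p∣+∣q∣ (inside  ∷ p) (inside  ∷ q) = cong suc (begin
  ∣ p ∪ q ∣ + suc ∣ p ∩ q ∣  ≡⟨ +-suc _ _ ⟩
  suc (∣ p ∪ q ∣ + ∣ p ∩ q ∣) ≡⟨ cong suc (∣p∪q∣+∣p∩q∣≡∣p∣+∣q∣ p q) ⟩
  suc (∣ p ∣ + ∣ q ∣)         ≡⟨ +-suc _ _ ⟨
  ∣ p ∣ + suc ∣ q ∣           ∎)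
  where open ≡-Reasoning
∣p∪q∣+∣p∩q∣≡∣p∣+∣q∣ (inside  ∷ p) (outside ∷ q) = cong suc (∣p∪q∣+∣p∩q∣≡∣p∣+∣q∣ p q)
∣p∪q∣+∣p∩q∣≡∣p∣+∣q∣ (outside ∷ p) (inside  ∷ q) =
  trans (cong suc (∣p∪q∣+∣p∩q∣≡∣p∣+∣q∣ p q)) (sym (+-suc _ _))
∣p∪q∣+∣p∩q∣≡∣p∣+∣q∣ (outside ∷ p) (outside ∷ q) = ∣p∪q∣+∣p∩q∣≡∣p∣+∣q∣ p q

∣p∪q∣≤∣p∣+∣q∣ : ∀ (p q : Subset n) → ∣ p ∪ q ∣ ≤ ∣ p ∣ + ∣ q ∣
∣p∪q∣≤∣p∣+∣q∣ p q = ≤-trans (m≤m+n _ _) (≤-reflexive (∣p∪q∣+∣p∩q∣≡∣p∣+∣q∣ p q))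

∣p∪q∪r∣≤∣p∣+∣q∣+∣r∣ : ∀ (p q r : Subset n) → ∣ p ∪ q ∪ r ∣ ≤ ∣ p ∣ + ∣ q ∣ + ∣ r ∣
∣p∪q∪r∣≤∣p∣+∣q∣+∣r∣ p q r = begin
  ∣ p ∪ q ∪ r ∣           ≤⟨ ∣p∪q∣≤∣p∣+∣q∣ p (q ∪ r) ⟩
  ∣ p ∣ + ∣ q ∪ r ∣       ≤⟨ +-monoʳ-≤ ∣ p ∣ (∣p∪q∣≤∣p∣+∣q∣ q r) ⟩
  ∣ p ∣ + (∣ q ∣ + ∣ r ∣) ≡⟨ +-assoc ∣ p ∣ _ _ ⟨
  ∣ p ∣ + ∣ q ∣ + ∣ r ∣   ∎
  where open ≤-Reasoning

Empty[p∩q]⇒∣p∪q∣≡∣p∣+∣q∣ : ∀ (p q : Subset n) → Empty (p ∩ q) → ∣ p ∪ q ∣ ≡ ∣ p ∣ + ∣ q ∣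
Empty[p∩q]⇒∣p∪q∣≡∣p∣+∣q∣ {n} p q empty = begin
  ∣ p ∪ q ∣             ≡⟨ +-identityʳ _ ⟨
  ∣ p ∪ q ∣ + 0         ≡⟨ cong (∣ p ∪ q ∣ +_) (∣⊥∣≡0 n) ⟨
  ∣ p ∪ q ∣ + ∣ ∅ {n} ∣ ≡⟨ cong (λ s → ∣ p ∪ q ∣ + ∣ s ∣) (Empty-unique empty) ⟨
  ∣ p ∪ q ∣ + ∣ p ∩ q ∣ ≡⟨ ∣p∪q∣+∣p∩q∣≡∣p∣+∣q∣ p q ⟩
  ∣ p ∣ + ∣ q ∣         ∎
  where open ≡-Reasoning

∣p∣≡∣p∩q∣+∣p∩∁q∣ : ∀ (p q : Subset n) → ∣ p ∣ ≡ ∣ p ∩ q ∣ + ∣ p ∩ ∁ q ∣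
∣p∣≡∣p∩q∣+∣p∩∁q∣ []            []            = refl
∣p∣≡∣p∩q∣+∣p∩∁q∣ (inside  ∷ p) (inside  ∷ q) = cong suc (∣p∣≡∣p∩q∣+∣p∩∁q∣ p q)
∣p∣≡∣p∩q∣+∣p∩∁q∣ (inside  ∷ p) (outside ∷ q) =
  trans (cong suc (∣p∣≡∣p∩q∣+∣p∩∁q∣ p q)) (sym (+-suc _ _))
∣p∣≡∣p∩q∣+∣p∩∁q∣ (outside ∷ p) (_       ∷ q) = ∣p∣≡∣p∩q∣+∣p∩∁q∣ p q

∣p∣≡∣p∩q∣+∣p∩r∣+∣p∩∁[q∪r]∣ : ∀ (p q r : Subset n) → Empty (q ∩ r) →
                              ∣ p ∣ ≡ ∣ p ∩ q ∣ + ∣ p ∩ r ∣ + ∣ p ∩ ∁ (q ∪ r) ∣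
∣p∣≡∣p∩q∣+∣p∩r∣+∣p∩∁[q∪r]∣ p q r empty = begin
  ∣ p ∣                               ≡⟨ ∣p∣≡∣p∩q∣+∣p∩∁q∣ p (q ∪ r) ⟩
  ∣ p ∩ (q ∪ r) ∣ + rest              ≡⟨ cong (λ s → ∣ s ∣ + rest) (∩-distribˡ-∪ p q r) ⟩
  ∣ p ∩ q ∪ p ∩ r ∣ + rest            ≡⟨ cong (_+ rest) (Empty[p∩q]⇒∣p∪q∣≡∣p∣+∣q∣ _ _ empty′) ⟩
  ∣ p ∩ q ∣ + ∣ p ∩ r ∣ + rest        ∎
  where
  open ≡-Reasoning
  rest = ∣ p ∩ ∁ (q ∪ r) ∣
  empty′ : Empty ((p ∩ q) ∩ (p ∩ r))
  empty′ (w , w∈) with x∈p∩q⁻ (p ∩ q) (p ∩ r) w∈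
  ... | w∈p∩q , w∈p∩r = empty (w , x∈p∩q⁺ (proj₂ (x∈p∩q⁻ p q w∈p∩q) , proj₂ (x∈p∩q⁻ p r w∈p∩r)))

∣p∣≡∣q∩p∣+∣r∩p∣+∣∁[q∪r]∩p∣ : ∀ (p q r : Subset n) → Empty (q ∩ r) →
                              ∣ p ∣ ≡ ∣ q ∩ p ∣ + ∣ r ∩ p ∣ + ∣ ∁ (q ∪ r) ∩ p ∣
∣p∣≡∣q∩p∣+∣r∩p∣+∣∁[q∪r]∩p∣ p q r empty =
  trans (∣p∣≡∣p∩q∣+∣p∩r∣+∣p∩∁[q∪r]∣ p q r empty)
        (cong₂ _+_ (cong₂ _+_ (∣∩-comm∣ q) (∣∩-comm∣ r)) (∣∩-comm∣ (∁ (q ∪ r))))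
  where
  ∣∩-comm∣ : ∀ q → ∣ p ∩ q ∣ ≡ ∣ q ∩ p ∣
  ∣∩-comm∣ q = cong ∣_∣ (∩-comm p q)

Nonempty⇒0<∣p∣ : Nonempty p → 0 < ∣ p ∣
Nonempty⇒0<∣p∣ (w , w∈p) = ≤-<-trans z≤n (x∈p⇒∣p-x∣<∣p∣ w∈p)

0<∣p∣⇒Nonempty : 0 < ∣ p ∣ → Nonempty p
0<∣p∣⇒Nonempty {n} {p} 0<∣p∣ with nonempty? p
... | yes nonempty = nonempty
... | no  empty    = contradiction (trans (cong ∣_∣ (Empty-unique empty)) (∣⊥∣≡0 n)) (>⇒≢ 0<∣p∣)

∣p∣≡1⇒singleton : ∀ (p : Subset n) → ∣ p ∣ ≡ 1 → ∃[ a ] (a ∈ p × ∀ {u} → u ∈ p → u ≡ a)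
∣p∣≡1⇒singleton p ∣p∣≡1 with 0<∣p∣⇒Nonempty (≤-reflexive (sym ∣p∣≡1))
... | a , a∈p = a , a∈p , unique
  where
  unique : ∀ {u} → u ∈ p → u ≡ a
  unique {u} u∈p with u ≟ a
  ... | yes u≡a = u≡a
  ... | no  u≢a = ⊥-elim (1+n≰n (begin-strict
    1          ≤⟨ Nonempty⇒0<∣p∣ (a , x∈p∧x≢y⇒x∈p-y a∈p (u≢a ∘ sym)) ⟩
    ∣ p - u ∣  <⟨ x∈p⇒∣p-x∣<∣p∣ u∈p ⟩
    ∣ p ∣      ≡⟨ ∣p∣≡1 ⟩
    1          ∎))
    where open ≤-Reasoning

∣∷∣-cong : ∀ b → ∣ p ∣ ≡ ∣ q ∣ → ∣ b ∷ p ∣ ≡ ∣ b ∷ q ∣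
∣∷∣-cong inside  = cong suc
∣∷∣-cong outside = id

∣∷∷∣-swap : ∀ b c (p : Subset n) → ∣ b ∷ c ∷ p ∣ ≡ ∣ c ∷ b ∷ p ∣
∣∷∷∣-swap inside  inside  p = refl
∣∷∷∣-swap inside  outside p = refl
∣∷∷∣-swap outside inside  p = refl
∣∷∷∣-swap outside outside p = refl

∣tabulate∣-punchIn : ∀ (f : Fin (suc n) → Bool) a →
                     ∣ tabulate f ∣ ≡ ∣ f a ∷ tabulate (f ∘ punchIn a) ∣
∣tabulate∣-punchIn             f zero    = refl
∣tabulate∣-punchIn {n = suc n} f (suc a) = begin
  ∣ f zero ∷ tabulate (f ∘ suc) ∣  ≡⟨ ∣∷∣-cong {p = tabulate (f ∘ suc)} {q = f (suc a) ∷ rest} (f zero)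
                                                (∣tabulate∣-punchIn (f ∘ suc) a) ⟩
  ∣ f zero ∷ f (suc a) ∷ rest ∣    ≡⟨ ∣∷∷∣-swap (f zero) (f (suc a)) rest ⟩
  ∣ f (suc a) ∷ f zero ∷ rest ∣    ∎
  where
  open ≡-Reasoning
  rest = tabulate (f ∘ suc ∘ punchIn a)

x∉p-x : ∀ (p : Subset n) w → w ∉ p - w
x∉p-x (_ ∷ p) zero    ()
x∉p-x (_ ∷ p) (suc w) (there w∈p-w) = x∉p-x p w w∈p-w

∉-∪⁺ : w ∉ p → w ∉ q → w ∉ p ∪ q
∉-∪⁺ {p = p} {q = q} w∉p w∉q = [ w∉p , w∉q ] ∘ x∈p∪q⁻ p q

∉-∪⁻ : w ∉ p ∪ q → w ∉ p × w ∉ q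
∉-∪⁻ w∉p∪q = w∉p∪q ∘ x∈p∪q⁺ ∘ inj₁ , w∉p∪q ∘ x∈p∪q⁺ ∘ inj₂

∉-∩ˡ : ∀ (p q : Subset n) → w ∉ p → w ∉ p ∩ q
∉-∩ˡ p q w∉p = w∉p ∘ proj₁ ∘ x∈p∩q⁻ p q

∉-∩ʳ : ∀ (p q : Subset n) → w ∉ q → w ∉ p ∩ q
∉-∩ʳ p q w∉q = w∉q ∘ proj₂ ∘ x∈p∩q⁻ p q

∈-tabulate⁺ : (f : Fin n → Bool) → f w ≡ true → w ∈ tabulate f
∈-tabulate⁺ {w = w} f fw = lookup⇒[]= w (tabulate f) (trans (lookup∘tabulate f w) fw)

∈-tabulate⁻ : (f : Fin n → Bool) → w ∈ tabulate f → f w ≡ true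
∈-tabulate⁻ {w = w} f w∈ = trans (sym (lookup∘tabulate f w)) ([]=⇒lookup w∈)

∉⇒lookup≡false : w ∉ p → lookup p w ≡ false
∉⇒lookup≡false {w = w} {p = p} w∉p = ¬-not (w∉p ∘ lookup⇒[]= w p)

anyFin⁺ : (f : Fin n → Bool) → f w ≡ true → anyFin f ≡ true
anyFin⁺ {w = zero}  f fw rewrite fw = refl
anyFin⁺ {w = suc w} f fw with f zero
... | true  = refl
... | false = anyFin⁺ (f ∘ suc) fw

anyFin⁻ : (f : Fin n → Bool) → anyFin f ≡ true → ∃[ w ] f w ≡ true
anyFin⁻ {suc n} f any with f zero in f0
... | true  = zero , f0
... | false with anyFin⁻ (f ∘ suc) any
...   | w , fw = suc w , fw

∈-N⁺ : u ∈ A → G u w ≡ true → w ∉ A → w ∈ N G A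
∈-N⁺ {u = u} {A = A} {G = G} {w = w} u∈A uw w∉A =
  ∈-tabulate⁺ _ (cong₂ _∧_ (cong not (∉⇒lookup≡false w∉A))
                           (anyFin⁺ (λ u → lookup A u ∧ G u w) (cong₂ _∧_ ([]=⇒lookup u∈A) uw)))

∈-N⁻ : w ∈ N G A → w ∉ A × ∃[ u ] (u ∈ A × G u w ≡ true)
∈-N⁻ {w = w} {G = G} {A = A} w∈N with ∈-tabulate⁻ _ w∈N
... | w∈N′ with anyFin⁻ (λ u → lookup A u ∧ G u w) (∧-conicalʳ _ _ w∈N′)
...   | u , Au∧uw = w∉A , u , lookup⇒[]= u A (∧-conicalˡ _ _ Au∧uw) , ∧-conicalʳ _ _ Au∧uw
  where
  w∉A : w ∉ A
  w∉A w∈A = contradiction (trans (sym (∧-conicalˡ _ _ w∈N′)) (cong not ([]=⇒lookup w∈A))) λ ()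

∈-nbhd∩⁻ : w ∈ nbhd G v ∩ A → G v w ≡ true × w ∈ A
∈-nbhd∩⁻ {G = G} {v = v} {A = A} w∈ with x∈p∩q⁻ (nbhd G v) A w∈
... | w∈nbhd , w∈A = ∈-tabulate⁻ (G v) w∈nbhd , w∈A

∈-nbhd∩⁺ : G v w ≡ true → w ∈ A → w ∈ nbhd G v ∩ A
∈-nbhd∩⁺ {G = G} {v = v} vw w∈A = x∈p∩q⁺ (∈-tabulate⁺ (G v) vw , w∈A)

Closed : Graph n → Subset n → Subset n → Set
Closed G Q P = ∀ {u v} → u ∈ P → G u v ≡ true → v ∉ Q → v ∈ P

Reach-Closed : Closed G q p → Reach G q u v → u ∈ p → v ∈ p
Reach-Closed closed here               u∈p = u∈p
Reach-Closed closed (step uv v∉q walk) u∈p = Reach-Closed closed walk (closed u∈p uv v∉q)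

Closed⇒Disconnected : Closed G q p → u ∈ p → u ∉ q → v ∉ p → v ∉ q → Disconnected G q
Closed⇒Disconnected closed u∈p u∉q v∉p v∉q =
  _ , _ , u∉q , v∉q , λ walk → v∉p (Reach-Closed closed walk u∈p)

Closed⇒k≤∣q∣ : KConnected k G → Closed G q p → u ∈ p → u ∉ q → v ∉ p → v ∉ q → k ≤ ∣ q ∣
Closed⇒k≤∣q∣ {q = q} (_ , no-small-cut) closed u∈p u∉q v∉p v∉q =
  ≮⇒≥ λ ∣q∣<k → no-small-cut q ∣q∣<k (Closed⇒Disconnected closed u∈p u∉q v∉p v∉q)

UnionOfComponents⇒Closed : UnionOfComponents G T X → Closed G T X
UnionOfComponents⇒Closed {X = X} (_ , no-edge) {v = v} u∈X uv v∉T with v ∈? X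
... | yes v∈X = v∈X
... | no  v∉X = contradiction (trans (sym uv) (no-edge _ _ u∈X v∉T v∉X)) λ ()

UnionOfComponents⇒Closed-∁ : (∀ u v → G u v ≡ G v u) → UnionOfComponents G T X →
                             Closed G T (∁ (T ∪ X))
UnionOfComponents⇒Closed-∁ {X = X} G-sym (_ , no-edge) {u} {v} u∈∁ uv v∉T = x∉p⇒x∈∁p (∉-∪⁺ v∉T v∉X)
  where
  u∉T∪X = ∉-∪⁻ (x∈∁p⇒x∉p u∈∁)
  v∉X : v ∉ X
  v∉X v∈X =
    contradiction (trans (sym uv) (trans (G-sym u v) (no-edge v u v∈X (proj₁ u∉T∪X) (proj₂ u∉T∪X)))) λ ()

UnionOfComponents⇒N⊆ : UnionOfComponents G T A → N G A ⊆ T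
UnionOfComponents⇒N⊆ {T = T} (_ , no-edge) {w} w∈N with w ∈? T | ∈-N⁻ w∈N
... | yes w∈T | _ = w∈T
... | no  w∉T | w∉A , u , u∈A , uw = contradiction (trans (sym uw) (no-edge u w u∈A w∉T w∉A)) λ ()

⌊⌋-true : ∀ {ℓ} {P : Set ℓ} (P? : Dec P) → P → ⌊ P? ⌋ ≡ true
⌊⌋-true P? p = trans (isYes≗does P?) (dec-true P? p)

⌊⌋-false : ∀ {ℓ} {P : Set ℓ} (P? : Dec P) → ¬ P → ⌊ P? ⌋ ≡ false
⌊⌋-false P? ¬p = trans (isYes≗does P?) (dec-false P? ¬p)

module Contraction {m} (G : Graph (suc m)) (G-sym : ∀ u v → G u v ≡ G v u)
                   {x a : Fin (suc m)} (a≢x : a ≢ x) where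

  G/xa : Graph m
  G/xa = contract G x a

  x′ : Fin m
  x′ = punchOut a≢x

  merge : Fin (suc m) → Fin m
  merge w with a ≟ w
  ... | yes _   = x′
  ... | no  a≢w = punchOut a≢w

  lift : Subset m → Subset (suc m)
  lift S = tabulate (lookup S ∘ merge)

  merge-a : merge a ≡ x′
  merge-a with a ≟ a
  ... | yes _   = refl
  ... | no  a≢a = contradiction refl a≢a

  punchIn-merge : w ≢ a → punchIn a (merge w) ≡ w
  punchIn-merge {w} w≢a with a ≟ w
  ... | yes a≡w = contradiction (sym a≡w) w≢a
  ... | no  a≢w = punchIn-punchOut a≢w

  punchIn-merge-a : punchIn a (merge a) ≡ x
  punchIn-merge-a = trans (cong (punchIn a) merge-a) (punchIn-punchOut a≢x)

  merge-punchIn : merge (punchIn a i) ≡ i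
  merge-punchIn {i} = punchIn-injective a _ _ (punchIn-merge (punchInᵢ≢i a i))

  merge-x : merge x ≡ x′
  merge-x = punchIn-injective a _ _ (trans (punchIn-merge (a≢x ∘ sym)) (sym (punchIn-punchOut a≢x)))

  contract-edge : i ≢ j →
                  G (punchIn a i) (punchIn a j) ≡ true
                  ⊎ (punchIn a i ≡ x × G (punchIn a j) a ≡ true)
                  ⊎ (punchIn a j ≡ x × G (punchIn a i) a ≡ true) →
                  G/xa i j ≡ true
  contract-edge {i} {j} i≢j edge rewrite ⌊⌋-false (i ≟ j) i≢j with edge
  ... | inj₁ uv rewrite uv = refl
  ... | inj₂ (inj₁ (u≡x , va)) rewrite ⌊⌋-true (punchIn a i ≟ x) u≡x | va =
    ∨-zeroʳ (G (punchIn a i) (punchIn a j))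
  ... | inj₂ (inj₂ (v≡x , ua)) rewrite ⌊⌋-true (punchIn a j ≟ x) v≡x | ua
                                      | ∨-zeroʳ (⌊ punchIn a i ≟ x ⌋ ∧ G (punchIn a j) a) =
    ∨-zeroʳ (G (punchIn a i) (punchIn a j))

  merge-edge : G u v ≡ true → merge u ≡ merge v ⊎ G/xa (merge u) (merge v) ≡ true
  merge-edge {u} {v} uv = edge-or-merged (merge u ≟ merge v)
    where
    lifted-edge : merge u ≢ merge v → Dec (u ≡ a) → Dec (v ≡ a) →
                  G (punchIn a (merge u)) (punchIn a (merge v)) ≡ true
                  ⊎ (punchIn a (merge u) ≡ x × G (punchIn a (merge v)) a ≡ true)
                  ⊎ (punchIn a (merge v) ≡ x × G (punchIn a (merge u)) a ≡ true)
    lifted-edge mu≢mv (yes refl) (yes refl) = contradiction refl mu≢mv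
    lifted-edge _     (yes refl) (no v≢a)   =
      inj₂ (inj₁ (punchIn-merge-a ,
                  trans (cong (λ s → G s a) (punchIn-merge v≢a)) (trans (G-sym v a) uv)))
    lifted-edge _     (no u≢a)   (yes refl) =
      inj₂ (inj₂ (punchIn-merge-a , trans (cong (λ s → G s a) (punchIn-merge u≢a)) uv))
    lifted-edge _     (no u≢a)   (no v≢a)   =
      inj₁ (trans (cong₂ G (punchIn-merge u≢a) (punchIn-merge v≢a)) uv)

    edge-or-merged : Dec (merge u ≡ merge v) → merge u ≡ merge v ⊎ G/xa (merge u) (merge v) ≡ true
    edge-or-merged (yes mu≡mv) = inj₁ mu≡mv
    edge-or-merged (no  mu≢mv) = inj₂ (contract-edge mu≢mv (lifted-edge mu≢mv (u ≟ a) (v ≟ a)))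

  ∈-lift⁺ : ∀ S → merge w ∈ S → w ∈ lift S
  ∈-lift⁺ S = ∈-tabulate⁺ (lookup S ∘ merge) ∘ []=⇒lookup

  ∈-lift⁻ : ∀ S → w ∈ lift S → merge w ∈ S
  ∈-lift⁻ {w} S = lookup⇒[]= (merge w) S ∘ ∈-tabulate⁻ (lookup S ∘ merge)

  ∣lift∣ : ∀ S → ∣ lift S ∣ ≡ ∣ lookup S x′ ∷ S ∣
  ∣lift∣ S = begin
    ∣ tabulate (lookup S ∘ merge) ∣        ≡⟨ ∣tabulate∣-punchIn (lookup S ∘ merge) a ⟩
    ∣ lookup S (merge a) ∷ rest ∣          ≡⟨ cong₂ (λ b s → ∣ b ∷ s ∣) (cong (lookup S) merge-a) rest≡S ⟩
    ∣ lookup S x′ ∷ S ∣                    ∎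
    where
    open ≡-Reasoning
    rest = tabulate (lookup S ∘ merge ∘ punchIn a)
    rest≡S : rest ≡ S
    rest≡S = trans (tabulate-cong λ _ → cong (lookup S) merge-punchIn) (tabulate∘lookup S)

  ∣lift∣-∈ : x′ ∈ S → ∣ lift S ∣ ≡ suc ∣ S ∣
  ∣lift∣-∈ {S} x′∈S = trans (∣lift∣ S) (cong (λ b → ∣ b ∷ S ∣) ([]=⇒lookup x′∈S))

  ∣lift∣-∉ : x′ ∉ S → ∣ lift S ∣ ≡ ∣ S ∣
  ∣lift∣-∉ {S} x′∉S = trans (∣lift∣ S) (cong (λ b → ∣ b ∷ S ∣) (∉⇒lookup≡false x′∉S))

  ∣S∣≤∣lift∣ : ∀ S → ∣ S ∣ ≤ ∣ lift S ∣
  ∣S∣≤∣lift∣ S = ≤-trans (∣p∣≤∣x∷p∣ (lookup S x′) S) (≤-reflexive (sym (∣lift∣ S)))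

  ∣lift∣≤1+∣S∣ : ∀ S → ∣ lift S ∣ ≤ suc ∣ S ∣
  ∣lift∣≤1+∣S∣ S with x′ ∈? S
  ... | yes x′∈S = ≤-reflexive (∣lift∣-∈ x′∈S)
  ... | no  x′∉S = ≤-trans (≤-reflexive (∣lift∣-∉ x′∉S)) (n≤1+n ∣ S ∣)

  Reach-merge : Reach G (lift S) u v → Reach G/xa S (merge u) (merge v)
  Reach-merge here = here
  Reach-merge (step uv v∉S* walk) with merge-edge uv
  ... | inj₁ mu≡mv = subst (λ s → Reach G/xa _ s _) (sym mu≡mv) (Reach-merge walk)
  ... | inj₂ e     = step e (v∉S* ∘ ∈-lift⁺ _) (Reach-merge walk)

  Disconnected-lift : Disconnected G/xa S → Disconnected G (lift S)
  Disconnected-lift {S} (i , j , i∉S , j∉S , ¬walk) =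
    punchIn a i , punchIn a j , punchIn∉lift i∉S , punchIn∉lift j∉S ,
    λ walk → ¬walk (subst₂ (Reach G/xa S) merge-punchIn merge-punchIn (Reach-merge walk))
    where
    punchIn∉lift : ∀ {l} → l ∉ S → punchIn a l ∉ lift S
    punchIn∉lift l∉S = l∉S ∘ subst (_∈ S) merge-punchIn ∘ ∈-lift⁻ S

  UnionOfComponents-lift : UnionOfComponents G/xa S X → UnionOfComponents G (lift S) (lift X)
  UnionOfComponents-lift {S} {X} (X∩S=∅ , no-edge) =
    (λ w w∈X* w∈S* → X∩S=∅ _ (∈-lift⁻ X w∈X*) (∈-lift⁻ S w∈S*)) ,
    λ u v u∈X* v∉S* v∉X* → ¬-not λ uv → case merge-edge uv of λ where
      (inj₁ mu≡mv) → v∉X* (∈-lift⁺ X (subst (_∈ X) mu≡mv (∈-lift⁻ X u∈X*)))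
      (inj₂ e)     → contradiction
        (trans (sym e) (no-edge _ _ (∈-lift⁻ X u∈X*) (v∉S* ∘ ∈-lift⁺ S) (v∉X* ∘ ∈-lift⁺ X))) λ ()

  KConnected-contract : KConnected (suc k) G → KConnected k G/xa
  KConnected-contract (k<n , no-small-cut) =
    ≤-pred k<n ,
    λ S ∣S∣<k cut →
      no-small-cut (lift S) (≤-trans (s≤s (∣lift∣≤1+∣S∣ S)) (s≤s ∣S∣<k)) (Disconnected-lift cut)

  NontrivialCut-lift : x′ ∈ S → NontrivialCut k G/xa S → NontrivialCut (suc k) G (lift S)
  NontrivialCut-lift {S} x′∈S (∣S∣≡k , cut , X , components , 2≤∣X∣ , 2≤∣rest∣) =
    trans (∣lift∣-∈ x′∈S) (cong suc ∣S∣≡k) ,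
    Disconnected-lift cut ,
    lift X ,
    UnionOfComponents-lift components ,
    ≤-trans 2≤∣X∣ (∣S∣≤∣lift∣ X) ,
    ≤-trans 2≤∣rest∣ (≤-trans (∣S∣≤∣lift∣ (∁ (S ∪ X))) (p⊆q⇒∣p∣≤∣q∣ lift-rest⊆))
    where
    lift-rest⊆ : lift (∁ (S ∪ X)) ⊆ ∁ (lift S ∪ lift X)
    lift-rest⊆ w∈ = x∉p⇒x∈∁p (∉-∪⁺ (proj₁ w∉S∪X ∘ ∈-lift⁻ S) (proj₂ w∉S∪X ∘ ∈-lift⁻ X))
      where w∉S∪X = ∉-∪⁻ (x∈∁p⇒x∉p (∈-lift⁻ (∁ (S ∪ X)) w∈))

  QuasiConnected-contract : KConnected (suc k) G →
                            (∀ T → NontrivialCut (suc k) G T → x ∈ T → a ∈ T → ⊥) →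
                            QuasiConnected (suc k) G/xa
  QuasiConnected-contract {k} connected xa∉nontrivial-cut = KConnected-contract connected , no-cut
    where
    no-cut : ∀ S → ¬ NontrivialCut k G/xa S
    no-cut S nontrivial@(∣S∣≡k , cut , _) with x′ ∈? S
    ... | yes x′∈S = xa∉nontrivial-cut (lift S) (NontrivialCut-lift x′∈S nontrivial)
                       (∈-lift⁺ S (subst (_∈ S) (sym merge-x) x′∈S))
                       (∈-lift⁺ S (subst (_∈ S) (sym merge-a) x′∈S))
    ... | no  x′∉S = proj₂ connected (lift S) (s≤s (≤-reflexive (trans (∣lift∣-∉ x′∉S) ∣S∣≡k)))
                       (Disconnected-lift cut)

-- aS = |A ∩ S| and bS = |B ∩ S|; a side Y of the cut S is recorded as a = |A ∩ Y|,
-- t = |N(A) ∩ Y| and b = |B ∩ Y|.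
module CrossingArithmetic (aS bS : ℕ) where

  record Side (a t b : ℕ) : Set where
    field
      size     : 2 ≤ a + t + b
      A-corner : 0 < a → bS < t
      B-corner : 0 < b → aS ≤ t

  open Side

  module _ (aS+bS≤4 : aS + bS ≤ 4) where

    private
      drop-zeros : ∀ {k n} → k ≤ n + 0 + 0 → k ≤ n
      drop-zeros {n = n} k≤ = ≤-trans k≤ (≤-reflexive (trans (+-identityʳ (n + 0)) (+-identityʳ n)))

      size-empty : ∀ {t} → Side 0 t 0 → 2 ≤ t
      size-empty Y = ≤-trans (size Y) (≤-reflexive (+-identityʳ _))

      too-large : ∀ {tC tD} → 3 ≤ tC → 2 ≤ tD → tC + tD ≤ aS + bS → ⊥
      too-large 3≤tC 2≤tD tC+tD≤ = 1+n≰n (≤-trans (+-mono-≤ 3≤tC 2≤tD) (≤-trans tC+tD≤ aS+bS≤4))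

      swap : ∀ {k} x y z → k ≤ x + y + z → k ≤ x + z + y
      swap x y z k≤ = ≤-trans k≤ (≤-reflexive (xy∙z≈xz∙y x y z))

    crossed : ∀ {aC tC bC aD tD bD} → Side aC tC bC → Side aD tD bD →
              0 < aC → 0 < bD → aS + bS < tC + tD
    crossed C D 0<aC 0<bD = begin-strict
      aS + bS ≡⟨ +-comm aS bS ⟩
      bS + aS <⟨ +-mono-<-≤ (A-corner C 0<aC) (B-corner D 0<bD) ⟩
      _       ∎
      where open ≤-Reasoning

    A-corner-side : ∀ {aC tC bC aD tD bD} → Side aC tC bC → Side aD tD bD → 0 < aC →
                    tC + tD ≤ aS + bS → 2 ≤ bS + bC + bD → ⊥
    A-corner-side {bD = suc _} C D 0<aC tC+tD≤ _ = <⇒≱ (crossed C D 0<aC z<s) tC+tD≤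
    A-corner-side {bC = suc _} {aD = suc _} {tD = tD} {bD = zero} C D 0<aC tC+tD≤ _ =
      <⇒≱ (crossed D C z<s z<s) (≤-trans (≤-reflexive (+-comm tD _)) tC+tD≤)
    A-corner-side {bC = zero} {aD = suc _} {bD = zero} C D 0<aC tC+tD≤ 2≤B =
      too-large (≤-trans (s≤s 2≤bS) (A-corner C 0<aC)) (≤-trans 2≤bS (<⇒≤ (A-corner D z<s))) tC+tD≤
      where 2≤bS = drop-zeros 2≤B
    A-corner-side {bC = zero} {aD = zero} {bD = zero} C D 0<aC tC+tD≤ 2≤B =
      too-large (≤-trans (s≤s (drop-zeros 2≤B)) (A-corner C 0<aC)) (size-empty D) tC+tD≤
    A-corner-side {tC = tC} {bC = suc _} {aD = zero} {bD = zero} C D 0<aC tC+tD≤ _ =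
      too-large (≤-trans (s≤s 2≤bS) (A-corner C 0<aC)) 2≤tD tC+tD≤
      where
      2≤tD = size-empty D
      2≤bS = ≤-trans 2≤tD (+-cancelˡ-≤ tC _ _ (≤-trans tC+tD≤ (+-monoˡ-≤ bS (B-corner C z<s))))

    B-corner-side : ∀ {tC bC tD bD} → Side 0 tC bC → Side 0 tD bD → 0 < bC → 3 ≤ aS →
                    tC + tD ≤ aS + bS → ⊥
    B-corner-side {bD = zero}  C D 0<bC 3≤aS =
      too-large (≤-trans 3≤aS (B-corner C 0<bC)) (size-empty D)
    B-corner-side {bD = suc _} C D 0<bC 3≤aS =
      too-large (≤-trans 3≤aS (B-corner C 0<bC)) (≤-trans (n≤1+n 2) (≤-trans 3≤aS (B-corner D z<s)))

    crossing-arithmetic : ∀ {aC tC bC aD tD bD} → Side aC tC bC → Side aD tD bD →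
                          tC + tD ≤ aS + bS → 3 ≤ aS + aC + aD → 2 ≤ bS + bC + bD → ⊥
    crossing-arithmetic {aC = suc _} C D tC+tD≤ _ 2≤B = A-corner-side C D z<s tC+tD≤ 2≤B
    crossing-arithmetic {aC = zero} {tC} {bC} {suc _} {tD} {bD} C D tC+tD≤ _ 2≤B =
      A-corner-side D C z<s (≤-trans (≤-reflexive (+-comm tD tC)) tC+tD≤) (swap bS bC bD 2≤B)
    crossing-arithmetic {aC = zero} {bC = suc _} {aD = zero} C D tC+tD≤ 3≤A _ =
      B-corner-side C D z<s (drop-zeros 3≤A) tC+tD≤
    crossing-arithmetic {aC = zero} {tC} {zero} {zero} {tD} {suc _} C D tC+tD≤ 3≤A _ =
      B-corner-side D C z<s (drop-zeros 3≤A) (≤-trans (≤-reflexive (+-comm tD tC)) tC+tD≤)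
    crossing-arithmetic {aC = zero} {bC = zero} {aD = zero} {bD = zero} C D _ 3≤A 2≤B =
      1+n≰n (≤-trans (+-mono-≤ (drop-zeros 3≤A) (drop-zeros 2≤B)) aS+bS≤4)

module UniqueNeighbourInFragment
  {n} (G : Graph n) (G-sym : ∀ u v → G u v ≡ G v u) (connected : KConnected 5 G)
  {T A : Subset n} (T-minimum : ∀ T′ → Disconnected G T′ → ∣ T ∣ ≤ ∣ T′ ∣)
  (A-fragment : UnionOfComponents G T A)
  (3≤∣A∣ : 3 ≤ ∣ A ∣) (2≤∣B∣ : 2 ≤ ∣ ∁ (A ∪ N G A) ∣)
  {x a : Fin n} (x∈N : x ∈ N G A) (a∈A : a ∈ A) (a-unique : ∀ {u} → u ∈ A → G x u ≡ true → u ≡ a)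
  where

  NA B : Subset n
  NA = N G A
  B  = ∁ (A ∪ NA)

  A∩NA=∅ : Empty (A ∩ NA)
  A∩NA=∅ (w , w∈A∩NA) with x∈p∩q⁻ A NA w∈A∩NA
  ... | w∈A , w∈NA = proj₁ (∈-N⁻ w∈NA) w∈A

  ∈A⇒∉NA : ∀ {w} → w ∈ A → w ∉ NA
  ∈A⇒∉NA w∈A w∈NA = A∩NA=∅ (_ , x∈p∩q⁺ (w∈A , w∈NA))

  ∈B⁻ : ∀ {w} → w ∈ B → w ∉ A × w ∉ NA
  ∈B⁻ = ∉-∪⁻ ∘ x∈∁p⇒x∉p

  ∈B⁺ : ∀ {w} → w ∉ A → w ∉ NA → w ∈ B
  ∈B⁺ w∉A w∉NA = x∉p⇒x∈∁p (∉-∪⁺ w∉A w∉NA)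

  ∈B∧edge⇒∉A : ∀ {u v} → u ∈ B → G u v ≡ true → v ∉ A
  ∈B∧edge⇒∉A {u} {v} u∈B uv v∈A = proj₂ (∈B⁻ u∈B) (∈-N⁺ v∈A (trans (G-sym v u) uv) (proj₁ (∈B⁻ u∈B)))

  a∉B : a ∉ B
  a∉B a∈B = proj₁ (∈B⁻ a∈B) a∈A

  x∉A : x ∉ A
  x∉A = proj₁ (∈-N⁻ x∈N)

  module CutThrough {S C : Subset n} (∣S∣≡5 : ∣ S ∣ ≡ 5) (S-cut : Disconnected G S)
                    (C-components : UnionOfComponents G S C) (x∈S : x ∈ S) (a∈S : a ∈ S) where

    D : Subset n
    D = ∁ (S ∪ C)

    aS tS bS : ℕ
    aS = ∣ A ∩ S ∣
    tS = ∣ NA ∩ S ∣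
    bS = ∣ B ∩ S ∣

    open CrossingArithmetic aS bS

    5≡aS+tS+bS : 5 ≡ aS + tS + bS
    5≡aS+tS+bS = trans (sym ∣S∣≡5) (∣p∣≡∣q∩p∣+∣r∩p∣+∣∁[q∪r]∩p∣ S A NA A∩NA=∅)

    module SideOf {Y : Subset n} (Y-closed : Closed G S Y) (Y∩S=∅ : ∀ {w} → w ∈ Y → w ∉ S) where

      tY : ℕ
      tY = ∣ NA ∩ Y ∣

      A-corner : 0 < ∣ A ∩ Y ∣ → bS < tY
      A-corner 0<∣A∩Y∣ with 0<∣p∣⇒Nonempty 0<∣A∩Y∣
      ... | p , p∈A∩Y = +-cancelˡ-< (aS + tS) bS tY (begin-strict
        aS + tS + bS                ≡⟨ 5≡aS+tS+bS ⟨
        5                           ≤⟨ Closed⇒k≤∣q∣ connected closed p∈A∩Y p∉Q x∉A∩Y x∉Q ⟩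
        ∣ Q ∣                       ≤⟨ ∣p∪q∪r∣≤∣p∣+∣q∣+∣r∣ (A ∩ S) (NA ∩ S - x) (NA ∩ Y) ⟩
        aS + ∣ NA ∩ S - x ∣ + tY    <⟨ +-monoˡ-< tY (+-monoʳ-< aS (x∈p⇒∣p-x∣<∣p∣ (x∈p∩q⁺ (x∈N , x∈S)))) ⟩
        aS + tS + tY                ∎)
        where
        open ≤-Reasoning
        Q : Subset n
        Q = A ∩ S ∪ (NA ∩ S - x) ∪ NA ∩ Y
        p∈A = proj₁ (x∈p∩q⁻ A Y p∈A∩Y)
        p∉S = Y∩S=∅ (proj₂ (x∈p∩q⁻ A Y p∈A∩Y))
        p∉NA = ∈A⇒∉NA p∈A
        p∉Q : p ∉ Q
        p∉Q = ∉-∪⁺ (∉-∩ʳ A S p∉S) (∉-∪⁺ (∉-∩ˡ NA S p∉NA ∘ p─q⊆p (NA ∩ S) _) (∉-∩ˡ NA Y p∉NA))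
        x∉A∩Y : x ∉ A ∩ Y
        x∉A∩Y = x∉A ∘ proj₁ ∘ x∈p∩q⁻ A Y
        x∉Q : x ∉ Q
        x∉Q = ∉-∪⁺ (∉-∩ˡ A S x∉A) (∉-∪⁺ (x∉p-x (NA ∩ S) x) (∉-∩ʳ NA Y λ x∈Y → Y∩S=∅ x∈Y x∈S))
        closed : Closed G Q (A ∩ Y)
        closed {u} {v} u∈A∩Y uv v∉Q with x∈p∩q⁻ A Y u∈A∩Y | ∉-∪⁻ v∉Q
        ... | u∈A , u∈Y | v∉A∩S , v∉Q′ with ∉-∪⁻ v∉Q′ | v ∈? A | v ∈? S
        ...   | _ , v∉NA∩Y   | no  v∉A | no  v∉S =
          contradiction (x∈p∩q⁺ (∈-N⁺ u∈A uv v∉A , Y-closed u∈Y uv v∉S)) v∉NA∩Y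
        ...   | _            | yes v∈A | no  v∉S = x∈p∩q⁺ (v∈A , Y-closed u∈Y uv v∉S)
        ...   | _            | yes v∈A | yes v∈S = contradiction (x∈p∩q⁺ (v∈A , v∈S)) v∉A∩S
        ...   | v∉NA∩S-x , _ | no  v∉A | yes v∈S with v ≟ x
        ...     | yes refl =
          contradiction a∈S (Y∩S=∅ (subst (_∈ Y) (a-unique u∈A (trans (G-sym v u) uv)) u∈Y))
        ...     | no  v≢x  =
          contradiction (x∈p∧x≢y⇒x∈p-y (x∈p∩q⁺ (∈-N⁺ u∈A uv v∉A , v∈S)) v≢x) v∉NA∩S-x

      B-corner : 0 < ∣ B ∩ Y ∣ → aS ≤ tY
      B-corner 0<∣B∩Y∣ with 0<∣p∣⇒Nonempty 0<∣B∩Y∣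
      ... | p , p∈B∩Y = +-cancelˡ-≤ (tS + bS) aS tY (begin
        tS + bS + aS   ≡⟨ xy∙z≈yz∙x aS tS bS ⟨
        aS + tS + bS   ≡⟨ 5≡aS+tS+bS ⟨
        5              ≤⟨ Closed⇒k≤∣q∣ connected closed p∈B∩Y p∉Q (∉-∩ˡ B Y a∉B) a∉Q ⟩
        ∣ Q ∣          ≤⟨ ∣p∪q∪r∣≤∣p∣+∣q∣+∣r∣ (NA ∩ S) (B ∩ S) (NA ∩ Y) ⟩
        tS + bS + tY   ∎)
        where
        open ≤-Reasoning
        Q : Subset n
        Q = NA ∩ S ∪ B ∩ S ∪ NA ∩ Y
        p∉S = Y∩S=∅ (proj₂ (x∈p∩q⁻ B Y p∈B∩Y))
        p∉NA = proj₂ (∈B⁻ (proj₁ (x∈p∩q⁻ B Y p∈B∩Y)))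
        p∉Q : p ∉ Q
        p∉Q = ∉-∪⁺ (∉-∩ʳ NA S p∉S) (∉-∪⁺ (∉-∩ʳ B S p∉S) (∉-∩ˡ NA Y p∉NA))
        a∉NA = ∈A⇒∉NA a∈A
        a∉Q : a ∉ Q
        a∉Q = ∉-∪⁺ (∉-∩ˡ NA S a∉NA) (∉-∪⁺ (∉-∩ˡ B S a∉B) (∉-∩ˡ NA Y a∉NA))
        closed : Closed G Q (B ∩ Y)
        closed {u} {v} u∈B∩Y uv v∉Q with x∈p∩q⁻ B Y u∈B∩Y | ∉-∪⁻ v∉Q
        ... | u∈B , u∈Y | v∉NA∩S , v∉Q′ with ∉-∪⁻ v∉Q′ | v ∈? NA | v ∈? S
        ...   | _        , v∉NA∩Y | yes v∈NA | no  v∉S =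
          contradiction (x∈p∩q⁺ (v∈NA , Y-closed u∈Y uv v∉S)) v∉NA∩Y
        ...   | _                 | yes v∈NA | yes v∈S = contradiction (x∈p∩q⁺ (v∈NA , v∈S)) v∉NA∩S
        ...   | v∉B∩S    , _      | no  v∉NA | yes v∈S =
          contradiction (x∈p∩q⁺ (∈B⁺ (∈B∧edge⇒∉A u∈B uv) v∉NA , v∈S)) v∉B∩S
        ...   | _                 | no  v∉NA | no  v∉S =
          x∈p∩q⁺ (∈B⁺ (∈B∧edge⇒∉A u∈B uv) v∉NA , Y-closed u∈Y uv v∉S)

      side : 2 ≤ ∣ Y ∣ → Side (∣ A ∩ Y ∣) tY (∣ B ∩ Y ∣)
      side 2≤∣Y∣ = record
        { size     = ≤-trans 2≤∣Y∣ (≤-reflexive (∣p∣≡∣q∩p∣+∣r∩p∣+∣∁[q∪r]∩p∣ Y A NA A∩NA=∅))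
        ; A-corner = A-corner
        ; B-corner = B-corner
        }

    S∩C=∅ : Empty (S ∩ C)
    S∩C=∅ (w , w∈S∩C) with x∈p∩q⁻ S C w∈S∩C
    ... | w∈S , w∈C = proj₁ C-components w w∈C w∈S

    column : ∀ P → ∣ P ∣ ≡ ∣ P ∩ S ∣ + ∣ P ∩ C ∣ + ∣ P ∩ D ∣
    column P = ∣p∣≡∣p∩q∣+∣p∩r∣+∣p∩∁[q∪r]∣ P S C S∩C=∅

    aS+bS≤4 : aS + bS ≤ 4
    aS+bS≤4 = ≤-pred (begin
      1 + (aS + bS)   ≤⟨ +-monoˡ-≤ (aS + bS) (Nonempty⇒0<∣p∣ (x , x∈p∩q⁺ (x∈N , x∈S))) ⟩
      tS + (aS + bS)  ≡⟨ xy∙z≈y∙xz aS tS bS ⟨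
      aS + tS + bS    ≡⟨ 5≡aS+tS+bS ⟨
      5               ∎)
      where open ≤-Reasoning

    tC+tD≤aS+bS : ∣ NA ∩ C ∣ + ∣ NA ∩ D ∣ ≤ aS + bS
    tC+tD≤aS+bS = +-cancelˡ-≤ tS _ _ (begin
      tS + (∣ NA ∩ C ∣ + ∣ NA ∩ D ∣)  ≡⟨ +-assoc tS _ _ ⟨
      tS + ∣ NA ∩ C ∣ + ∣ NA ∩ D ∣    ≡⟨ column NA ⟨
      ∣ NA ∣                          ≤⟨ p⊆q⇒∣p∣≤∣q∣ (UnionOfComponents⇒N⊆ A-fragment) ⟩
      ∣ T ∣                           ≤⟨ T-minimum S S-cut ⟩
      ∣ S ∣                           ≡⟨ trans ∣S∣≡5 5≡aS+tS+bS ⟩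
      aS + tS + bS                    ≡⟨ xy∙z≈y∙xz aS tS bS ⟩
      tS + (aS + bS)                  ∎)
      where open ≤-Reasoning

    module C-side = SideOf (UnionOfComponents⇒Closed C-components) (proj₁ C-components _)
    module D-side = SideOf (UnionOfComponents⇒Closed-∁ G-sym C-components)
                           (λ w∈D w∈S → x∈∁p⇒x∉p w∈D (x∈p∪q⁺ (inj₁ w∈S)))

    sides-not-both-large : 2 ≤ ∣ C ∣ → 2 ≤ ∣ D ∣ → ⊥
    sides-not-both-large 2≤∣C∣ 2≤∣D∣ =
      crossing-arithmetic aS+bS≤4 (C-side.side 2≤∣C∣) (D-side.side 2≤∣D∣) tC+tD≤aS+bS
        (≤-trans 3≤∣A∣ (≤-reflexive (column A))) (≤-trans 2≤∣B∣ (≤-reflexive (column B)))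

  xa∉NontrivialCut : ∀ S → NontrivialCut 5 G S → x ∈ S → a ∈ S → ⊥
  xa∉NontrivialCut S (∣S∣≡5 , S-cut , C , C-components , 2≤∣C∣ , 2≤∣D∣) x∈S a∈S =
    CutThrough.sides-not-both-large ∣S∣≡5 S-cut C-components x∈S a∈S 2≤∣C∣ 2≤∣D∣

∣nbhd∩A∣≡1⇒unique : ∀ (G : Graph n) v A → ∣ nbhd G v ∩ A ∣ ≡ 1 →
                    ∃[ a ] (a ∈ A × G v a ≡ true × ∀ {u} → u ∈ A → G v u ≡ true → u ≡ a)
∣nbhd∩A∣≡1⇒unique G v A ∣nbhd∩A∣≡1 with ∣p∣≡1⇒singleton (nbhd G v ∩ A) ∣nbhd∩A∣≡1
... | a , a∈ , unique = a , proj₂ a∈′ , proj₁ a∈′ , λ u∈A vu → unique (∈-nbhd∩⁺ {G = G} {v = v} vu u∈A)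
  where a∈′ = ∈-nbhd∩⁻ {G = G} {v = v} {A = A} a∈

lemma1 : ∀ {n} (G : Graph n) → IsSimple G → KConnected 5 G →
           ContractionCriticalQuasi 5 G → (A : Subset n) →
           NontrivialFragment G A →
           (∃[ x ] (x ∈ N G A × ∣ nbhd G x ∩ A ∣ ≡ 1)) →
           ∣ A ∣ ≡ 2
lemma1 {zero} G _ (() , _) _ _ _ _
lemma1 {suc m} G (G-sym , _) connected (_ , contraction-critical) A
       ((T , (_ , T-minimum) , A-fragment , _) , 2≤∣A∣ , 2≤∣B∣) (x , x∈N , ∣N[x]∩A∣≡1)
       with m≤n⇒m<n∨m≡n 2≤∣A∣ | ∣nbhd∩A∣≡1⇒unique G x A ∣N[x]∩A∣≡1
... | inj₂ 2≡∣A∣ | _                       = sym 2≡∣A∣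
... | inj₁ 3≤∣A∣ | a , a∈A , xa , a-unique =
  ⊥-elim (contraction-critical x a xa (QuasiConnected-contract connected xa∉NontrivialCut))
  where
  open UniqueNeighbourInFragment G G-sym connected T-minimum A-fragment 3≤∣A∣ 2≤∣B∣ x∈N a∈A a-unique
  open Contraction G G-sym {x} {a} (λ a≡x → x∉A (subst (_∈ A) a≡x a∈A))
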